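{- Let $\ell>0$ and $b\neq0$ be integers with $\ell^2+4b\geq0$, and let $\mathbf{s}$ be defined by $s_0=0$, $s_1=1$, $s_j=\ell s_{j-1}+bs_{j-2}$ for $j\geq2$. If $\gcd(\ell,b)=\gcd(\ell^2,b)=r$, then for all $n\geq1$, $$\gcd(s_{n+1},s_n)=r^{\lfloor n/2\rfloor}.$$ -}

module Defs where

open import Data.Nat using (ℕ; zero; suc)
open import Data.Integer using (ℤ; _+_; _*_; 0ℤ; 1ℤ)

s : ℤ → ℤ → ℕ → ℤ
s l b zero = 0ℤ
s l b (suc zero) = 1ℤ
s l b (suc (suc j)) = l * s l b (suc j) + b * s l b j

module Submission where

-- Write r = gcd(ℓ, b), ℓ = ℓ'·r and b = b'·r.  The hypothesis gcd(ℓ², b) = r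
-- says gcd(ℓ'·ℓ'·r, b') = 1, so b' is coprime both to ℓ' and to r.
--
-- Pulling the common factor r out of the recurrence gives s_n = r^⌊n/2⌋ · u_n,
-- where u_0 = 0, u_1 = 1 and u_{n+2} = ℓ'·w_n·u_{n+1} + b'·u_n, and w_n is 1
-- for even n and r for odd n (it records that r^⌊(n+1)/2⌋ = r^⌊n/2⌋ · w_n).
-- By induction, u_{n+1} and w_n are coprime to b', and consecutive terms of u
-- are coprime, as are w_n and u_n.  Hence
--   gcd(s_{n+1}, s_n) = r^⌊n/2⌋ · gcd(w_n·u_{n+1}, u_n) = r^⌊n/2⌋.

open import Defs
open import Data.Nat using (ℕ; zero; suc; _/_; s≤s; z≤n) renaming (_≤_ to _≤ℕ_)
import Data.Nat as ℕ
import Data.Nat.Divisibility as ℕD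
import Data.Nat.Coprimality as ℕC
import Data.Nat.GCD as ℕG
open import Data.Nat.DivMod using (m/n≡1+[m∸n]/n)
open import Data.Integer using (ℤ; _+_; _*_; _^_; _<_; _≤_; 0ℤ; 1ℤ; +_; -[1+_]; ∣_∣)
open import Data.Integer.Properties using (abs-*; pos-*; +-injective; +-comm; *-comm; *-assoc; *-identityˡ; *-identityʳ; *-cancelˡ-≡)
open import Data.Integer.GCD using (gcd; gcd[i,j]∣i; gcd[i,j]∣j; gcd[i,j]≡0⇒j≡0)
open import Data.Integer.Coprimality using (Coprime)
open import Data.Integer.Divisibility using (_∣_)
import Data.Integer.Coprimality as Coprimeℤ
open import Data.Integer.Divisibility.Signed as S
  using (divides; ∣ᵤ⇒∣; ∣⇒∣ᵤ; ∣-refl; ∣-trans; ∣m+n∣m⇒∣n; ∣m⇒∣m*n; ∣n⇒∣m*n)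
open import Data.Integer.Tactic.RingSolver using (solve-∀)
open import Data.Product using (_×_; _,_)
open import Relation.Binary.PropositionalEquality
open ≡-Reasoning

half-suc-suc : ∀ n → suc (suc n) / 2 ≡ suc (n / 2)
half-suc-suc n = m/n≡1+[m∸n]/n {suc (suc n)} {2} (s≤s (s≤s z≤n))

pos-^ : ∀ m k → (+ m) ^ k ≡ + (m ℕ.^ k)
pos-^ m zero = refl
pos-^ m (suc k) = trans (cong (+ m *_) (pos-^ m k)) (sym (pos-* m (m ℕ.^ k)))

coprime-1ˡ : ∀ a → Coprime 1ℤ a
coprime-1ˡ a = ℕC.1-coprimeTo ∣ a ∣

coprime-*ˡ : ∀ a b c → Coprime a c → Coprime b c → Coprime (a * b) c
coprime-*ˡ a b c a⊥c b⊥c {d} (d∣ab , d∣c) = b⊥c (d∣b , d∣c)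
  where
  d⊥a : ℕC.Coprime d ∣ a ∣
  d⊥a (e∣d , e∣a) = a⊥c (e∣a , ℕD.∣-trans e∣d d∣c)
  d∣b : d ℕD.∣ ∣ b ∣
  d∣b = ℕC.coprime-divisor d⊥a (subst (d ℕD.∣_) (abs-* a b) d∣ab)

coprime-factorˡ : ∀ a b c → Coprime (a * b) c → Coprime a c
coprime-factorˡ a b c ab⊥c (d∣a , d∣c) =
  ab⊥c (subst (_ ℕD.∣_) (sym (abs-* a b)) (ℕD.∣-trans d∣a (ℕD.m∣m*n ∣ b ∣)) , d∣c)

coprime-factorʳ : ∀ a b c → Coprime (a * b) c → Coprime b c
coprime-factorʳ a b c ab⊥c (d∣b , d∣c) =
  ab⊥c (subst (_ ℕD.∣_) (sym (abs-* a b)) (ℕD.∣-trans d∣b (ℕD.n∣m*n ∣ a ∣)) , d∣c)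

coprime-+-multiple : ∀ a b c → Coprime a b → b S.∣ c → Coprime (c + a) b
coprime-+-multiple a b c a⊥b b∣c {d} (d∣c+a , d∣b) = a⊥b (∣⇒∣ᵤ d∣a , d∣b)
  where
  d∣a : + d S.∣ a
  d∣a = ∣m+n∣m⇒∣n (∣ᵤ⇒∣ d∣c+a) (∣-trans (∣ᵤ⇒∣ d∣b) b∣c)

gcd-*ˡ : ∀ m x y → gcd (+ m * x) (+ m * y) ≡ + m * gcd x y
gcd-*ˡ m x y = begin
  + ℕG.gcd ∣ + m * x ∣ ∣ + m * y ∣         ≡⟨ cong +_ (cong₂ ℕG.gcd (abs-* (+ m) x) (abs-* (+ m) y)) ⟩
  + ℕG.gcd (m ℕ.* ∣ x ∣) (m ℕ.* ∣ y ∣)    ≡⟨ cong +_ (sym (ℕG.c*gcd[m,n]≡gcd[cm,cn] m ∣ x ∣ ∣ y ∣)) ⟩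
  + (m ℕ.* ℕG.gcd ∣ x ∣ ∣ y ∣)             ≡⟨ pos-* m _ ⟩
  + m * gcd x y                            ∎

gcd-*-coprime : ∀ m x y → Coprime x y → gcd (+ m * x) (+ m * y) ≡ + m
gcd-*-coprime m x y x⊥y = begin
  gcd (+ m * x) (+ m * y)  ≡⟨ gcd-*ˡ m x y ⟩
  + m * gcd x y            ≡⟨ cong (λ g → + m * + g) (ℕC.coprime⇒gcd≡1 x⊥y) ⟩
  + m * 1ℤ                 ≡⟨ *-identityʳ (+ m) ⟩
  + m                      ∎

gcd-*≡⇒coprime : ∀ m x y → m ≢ 0 → gcd (+ m * x) (+ m * y) ≡ + m → Coprime x y
gcd-*≡⇒coprime m x y m≢0 eq = ℕC.gcd≡1⇒coprime (+-injective gcd≡1)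
  where
  instance
    m-nonZero : ℕ.NonZero m
    m-nonZero = ℕ.≢-nonZero m≢0
  gcd≡1 : gcd x y ≡ 1ℤ
  gcd≡1 = *-cancelˡ-≡ (+ m) (gcd x y) 1ℤ
            (trans (sym (gcd-*ˡ m x y)) (trans eq (sym (*-identityʳ (+ m)))))

module Reduced (R : ℕ) (l' b' : ℤ) where

  r : ℤ
  r = + R

  -- w n = r^⌊(n+1)/2⌋ / r^⌊n/2⌋, i.e. 1 for even n and r for odd n.
  w : ℕ → ℤ
  w zero = 1ℤ
  w (suc zero) = r
  w (suc (suc n)) = w n

  u : ℕ → ℤ
  u zero = 0ℤ
  u (suc zero) = 1ℤ
  u (suc (suc n)) = l' * w n * u (suc n) + b' * u n

  r^-half-suc : ∀ n → r ^ (suc n / 2) ≡ r ^ (n / 2) * w n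
  r^-half-suc zero = refl
  r^-half-suc (suc zero) = trans (*-identityʳ r) (sym (*-identityˡ r))
  r^-half-suc (suc (suc n)) = begin
    r ^ (suc (suc (suc n)) / 2)   ≡⟨ cong (r ^_) (half-suc-suc (suc n)) ⟩
    r * r ^ (suc n / 2)           ≡⟨ cong (r *_) (r^-half-suc n) ⟩
    r * (r ^ (n / 2) * w n)       ≡⟨ *-assoc r (r ^ (n / 2)) (w n) ⟨
    r * r ^ (n / 2) * w n         ≡⟨ cong (λ k → r ^ k * w n) (half-suc-suc n) ⟨
    r ^ (suc (suc n) / 2) * w n   ∎

  s-factor : ∀ n → s (l' * r) (b' * r) n ≡ r ^ (n / 2) * u n
  s-factor zero = refl
  s-factor (suc zero) = refl
  s-factor (suc (suc n)) = begin
    l' * r * s l b (suc n) + b' * r * s l b n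
      ≡⟨ cong₂ (λ x y → l' * r * x + b' * r * y) (s-factor (suc n)) (s-factor n) ⟩
    l' * r * (r ^ (suc n / 2) * u (suc n)) + b' * r * (p * u n)
      ≡⟨ cong (λ x → l' * r * (x * u (suc n)) + b' * r * (p * u n)) (r^-half-suc n) ⟩
    l' * r * (p * w n * u (suc n)) + b' * r * (p * u n)
      ≡⟨ factor-out l' b' r p (w n) (u (suc n)) (u n) ⟩
    r * p * u (suc (suc n))
      ≡⟨ cong (λ k → r ^ k * u (suc (suc n))) (half-suc-suc n) ⟨
    r ^ (suc (suc n) / 2) * u (suc (suc n))
      ∎
    where
    l b p : ℤ
    l = l' * r
    b = b' * r
    p = r ^ (n / 2)
    factor-out : ∀ l' b' r p w x y →
      l' * r * (p * w * x) + b' * r * (p * y) ≡ r * p * (l' * w * x + b' * y)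
    factor-out = solve-∀

  module _ (l'⊥b' : Coprime l' b') (r⊥b' : Coprime r b') where

    w-coprime-b' : ∀ n → Coprime (w n) b'
    w-coprime-b' zero = coprime-1ˡ b'
    w-coprime-b' (suc zero) = r⊥b'
    w-coprime-b' (suc (suc n)) = w-coprime-b' n

    -- u (n + 2) ≡ (ℓ'·w n)·u (n + 1) modulo b', a product of units modulo b'.
    u-coprime-b' : ∀ n → Coprime (u (suc n)) b'
    u-coprime-b' zero = coprime-1ˡ b'
    u-coprime-b' (suc n) =
      subst (λ x → Coprime x b') (+-comm (b' * u n) (l' * w n * u (suc n)))
        (coprime-+-multiple (l' * w n * u (suc n)) b' (b' * u n)
          (coprime-*ˡ (l' * w n) (u (suc n)) b'
            (coprime-*ˡ l' (w n) b' l'⊥b' (w-coprime-b' n)) (u-coprime-b' n))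
          (∣m⇒∣m*n (u n) ∣-refl))

    -- Consecutive terms: u (n + 2) ≡ b'·u n modulo u (n + 1), as for Fibonacci.
    u-coprime-u : ∀ n → Coprime (u (suc n)) (u n)
    u-coprime-u zero = coprime-1ˡ 0ℤ
    u-coprime-u (suc n) =
      coprime-+-multiple (b' * u n) (u (suc n)) (l' * w n * u (suc n))
        (coprime-*ˡ b' (u n) (u (suc n))
          (Coprimeℤ.sym {u (suc n)} {b'} (u-coprime-b' n))
          (Coprimeℤ.sym {u (suc n)} {u n} (u-coprime-u n)))
        (∣n⇒∣m*n (l' * w n) ∣-refl)

    -- u n is coprime to w n (to r, for odd n): u (n + 2) ≡ b'·u n modulo w n.
    u-coprime-w : ∀ n → Coprime (u n) (w n)
    u-coprime-w zero = Coprimeℤ.sym {1ℤ} {0ℤ} (coprime-1ˡ 0ℤ)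
    u-coprime-w (suc zero) = coprime-1ˡ r
    u-coprime-w (suc (suc n)) =
      coprime-+-multiple (b' * u n) (w n) (l' * w n * u (suc n))
        (coprime-*ˡ b' (u n) (w n)
          (Coprimeℤ.sym {w n} {b'} (w-coprime-b' n)) (u-coprime-w n))
        (∣m⇒∣m*n (u (suc n)) (∣n⇒∣m*n l' ∣-refl))

    gcd-consecutive : ∀ n →
      gcd (s (l' * r) (b' * r) (suc n)) (s (l' * r) (b' * r) n) ≡ r ^ (n / 2)
    gcd-consecutive n = begin
      gcd (s l b (suc n)) (s l b n)
        ≡⟨ cong₂ gcd (s-factor (suc n)) (s-factor n) ⟩
      gcd (r ^ (suc n / 2) * u (suc n)) (p * u n)
        ≡⟨ cong (λ x → gcd (x * u (suc n)) (p * u n)) (r^-half-suc n) ⟩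
      gcd (p * w n * u (suc n)) (p * u n)
        ≡⟨ cong (λ x → gcd x (p * u n)) (*-assoc p (w n) (u (suc n))) ⟩
      gcd (p * (w n * u (suc n))) (p * u n)
        ≡⟨ cong (λ q → gcd (q * (w n * u (suc n))) (q * u n)) (pos-^ R (n / 2)) ⟩
      gcd (+ (R ℕ.^ (n / 2)) * (w n * u (suc n))) (+ (R ℕ.^ (n / 2)) * u n)
        ≡⟨ gcd-*-coprime (R ℕ.^ (n / 2)) (w n * u (suc n)) (u n) consecutive-coprime ⟩
      + (R ℕ.^ (n / 2))
        ≡⟨ pos-^ R (n / 2) ⟨
      p ∎
      where
      l b p : ℤ
      l = l' * r
      b = b' * r
      p = r ^ (n / 2)
      consecutive-coprime : Coprime (w n * u (suc n)) (u n)
      consecutive-coprime =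
        coprime-*ˡ (w n) (u (suc n)) (u n)
          (Coprimeℤ.sym {u n} {w n} (u-coprime-w n)) (u-coprime-u n)

gcd≢0 : ∀ l b {R} → b ≢ 0ℤ → gcd l b ≡ + R → R ≢ 0
gcd≢0 l b b≢0 gcd≡R R≡0 = b≢0 (gcd[i,j]≡0⇒j≡0 {l} (trans gcd≡R (cong +_ R≡0)))

quotients-coprime : ∀ R l' b' → R ≢ 0 →
  gcd (l' * + R * (l' * + R)) (b' * + R) ≡ + R → Coprime l' b' × Coprime (+ R) b'
quotients-coprime R l' b' R≢0 gcd[l²,b]≡r =
  coprime-factorˡ l' (l' * r) b' l'l'r⊥b' ,
  coprime-factorʳ l' r b' (coprime-factorʳ l' (l' * r) b' l'l'r⊥b')
  where
  r : ℤ
  r = + R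
  pull-out-r : ∀ l' r → l' * r * (l' * r) ≡ r * (l' * (l' * r))
  pull-out-r = solve-∀
  l'l'r⊥b' : Coprime (l' * (l' * r)) b'
  l'l'r⊥b' = gcd-*≡⇒coprime R (l' * (l' * r)) b' R≢0
    (trans (cong₂ gcd (sym (pull-out-r l' r)) (*-comm r b')) gcd[l²,b]≡r)

lemma3p7 : (l b r : ℤ) → 0ℤ < l → b ≢ 0ℤ → 0ℤ ≤ l * l + (+ 4) * b →
    gcd l b ≡ r → gcd (l * l) b ≡ r →
    (n : ℕ) → 1 ≤ℕ n →
    gcd (s l b (suc n)) (s l b n) ≡ r ^ (n / 2)
lemma3p7 l b -[1+ _ ] _ _ _ () _ _ _
lemma3p7 l b (+ R) _ b≢0 _ gcd[l,b]≡r gcd[l²,b]≡r n _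
  with divides l' refl ← ∣ᵤ⇒∣ {+ R} {l} (subst (_∣ l) gcd[l,b]≡r (gcd[i,j]∣i l b))
     | divides b' refl ← ∣ᵤ⇒∣ {+ R} {b} (subst (_∣ b) gcd[l,b]≡r (gcd[i,j]∣j l b))
  with l'⊥b' , r⊥b' ← quotients-coprime R l' b'
                        (gcd≢0 (l' * + R) (b' * + R) b≢0 gcd[l,b]≡r) gcd[l²,b]≡r
  = Reduced.gcd-consecutive R l' b' l'⊥b' r⊥b' n
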